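{- For an odd prime $p$, the underlying graph $\mathcal{G}_3(p)$ of the Farey map $\mathcal{M}_3(p)$ is a graph covering of order $\frac12(p-1)$ of the complete graph $K_{p+1}$ on $p+1$ vertices.
   Context: For a prime $p$, $\mathcal{G}_3(p)$ is the graph whose vertices are the pairs $(a,c)\in(\mathbb{Z}/p\mathbb{Z})^2\setminus\{(0,0)\}$ modulo $(a,c)\sim(-a,-c)$, written $[a/c]_p$, with $[a/c]_p$ and $[b/d]_p$ adjacent iff $ad-bc\equiv\pm1\pmod p$ (the underlying graph of the regular map $(\mathrm{PSL}_2(\mathbb{Z})/\Gamma(p),X\Gamma(p),Y\Gamma(p))$). A graph covering of a graph $\mathcal{G}_2$ by a graph $\mathcal{G}_1$ is a map $\pi$ from the vertex set of $\mathcal{G}_1$ to that of $\mathcal{G}_2$ preserving adjacency such that for every vertex $v$ of $\mathcal{G}_2$ and every $w\in\pi^{ -1}(v)$, $\pi$ restricts to a bijection from the set of neighbours of $w$ to the set of neighbours of $v$; it has order $h$ if every vertex of $\mathcal{G}_2$ has exactly $h$ preimages. -}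

module Defs where

open import Data.Nat as ℕ using (ℕ; suc)
open import Data.Integer as ℤ using (ℤ; +_; _-_; _*_; -_; 1ℤ)
open import Data.Integer.Divisibility using (_∣_)
open import Data.Fin using (Fin)
open import Data.Product using (Σ; ∃; ∃-syntax; _×_; _,_; proj₁; proj₂)
open import Data.Sum using (_⊎_)
open import Relation.Nullary using (¬_)
open import Relation.Binary.PropositionalEquality using (_≡_)

-- Graphs whose vertex set is given as a type together with an equivalence
-- relation _≈_ (the vertices are the ≈-classes) and an adjacency relation
-- respecting ≈, so that quotient vertex sets such as
-- ((ℤ/pℤ)² ∖ {0}) / ± can be represented faithfully.

record Graph : Set₁ where
  field
    V     : Set
    _≈_   : V → V → Set
    Adj   : V → V → Set

record IsCovering (G₁ G₂ : Graph) (π : Graph.V G₁ → Graph.V G₂) : Set where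
  private
    module G₁ = Graph G₁
    module G₂ = Graph G₂
  field
    resp  : ∀ {w w′} → w G₁.≈ w′ → π w G₂.≈ π w′
    adj   : ∀ {w w′} → G₁.Adj w w′ → G₂.Adj (π w) (π w′)
    onto  : ∀ w u → G₂.Adj (π w) u → ∃[ w′ ] (G₁.Adj w w′ × π w′ G₂.≈ u)
    inj   : ∀ w w₁ w₂ → G₁.Adj w w₁ → G₁.Adj w w₂ →
            π w₁ G₂.≈ π w₂ → w₁ G₁.≈ w₂

HasOrder : (G₁ G₂ : Graph) (π : Graph.V G₁ → Graph.V G₂) (h : ℕ) → Set
HasOrder G₁ G₂ π h =
  ∀ v → Σ (Fin h → G₁.V) λ ws →
      (∀ i → π (ws i) G₂.≈ v)
    × (∀ i j → ws i G₁.≈ ws j → i ≡ j)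
    × (∀ w → π w G₂.≈ v → ∃[ i ] (w G₁.≈ ws i))
  where
    module G₁ = Graph G₁
    module G₂ = Graph G₂

GraphCovering : (G₁ G₂ : Graph) (h : ℕ) → Set
GraphCovering G₁ G₂ h =
  Σ (Graph.V G₁ → Graph.V G₂) λ π → IsCovering G₁ G₂ π × HasOrder G₁ G₂ π h

infix 4 _≡_[mod_]
_≡_[mod_] : ℤ → ℤ → ℕ → Set
x ≡ y [mod p ] = (+ p) ∣ (x - y)

-- Vertices of 𝒢₃(p): pairs (a , c) of integers that are not both ≡ 0 mod p;
-- two such pairs represent the same vertex [a/c]_p iff they are equal
-- modulo p or negatives of each other modulo p.
G3Vertex : ℕ → Set
G3Vertex p = Σ (ℤ × ℤ) λ ac → ¬ ((proj₁ ac ≡ + 0 [mod p ]) × (proj₂ ac ≡ + 0 [mod p ]))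

G3Equiv : (p : ℕ) → G3Vertex p → G3Vertex p → Set
G3Equiv p ((a , c) , _) ((b , d) , _) =
    (a ≡ b [mod p ] × c ≡ d [mod p ])
  ⊎ (a ≡ - b [mod p ] × c ≡ - d [mod p ])

G3Adj : (p : ℕ) → G3Vertex p → G3Vertex p → Set
G3Adj p ((a , c) , _) ((b , d) , _) =
  (a * d - b * c ≡ 1ℤ [mod p ]) ⊎ (a * d - b * c ≡ - 1ℤ [mod p ])

𝒢₃ : ℕ → Graph
𝒢₃ p = record { V = G3Vertex p ; _≈_ = G3Equiv p ; Adj = G3Adj p }

K : ℕ → Graph
K n = record { V = Fin n ; _≈_ = _≡_ ; Adj = λ i j → ¬ (i ≡ j) }

-- A vertex [a/c] spans a point of the projective line over 𝔽ₚ, and this map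
-- onto the p + 1 points is the covering.  Adjacent vertices have
-- determinant ±1, hence span distinct points.  If det((a,c),(b,d)) = δ ≠ 0
-- then δ⁻¹(b,d) is the unique neighbour of [a/c] above the point of (b,d):
-- a neighbour κ(b,d) has det = κδ = ±1, so κ = ±δ⁻¹, i.e. the same vertex.
-- The vertices above a point are its nonzero multiples up to sign, and the
-- half system 1, …, (p-1)/2 of 𝔽ₚ* modulo ±1 enumerates them.

module Submission where

open import Defs
open import Data.Nat using (ℕ; suc; _∸_; _/_)
open import Data.Nat.Primality using (Prime)
open import Relation.Binary.PropositionalEquality using (_≢_)

import Data.Nat as ℕ
import Data.Nat.Properties as ℕ
open import Data.Nat.Divisibility using (_∣_; divides; _∣0; _∣?_; ∣1⇒≡1; n∣m⇒m%n≡0)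
open import Data.Nat.DivMod using (_%_; m%n<n; m≡m%n+[m/n]*n; m<n⇒m%n≡m)
open import Data.Nat.Primality using (prime⇒nonZero; prime⇒nonTrivial; prime⇒¬composite; composite-≢; euclidsLemma)
open import Data.Nat.Coprimality using (prime⇒coprime; coprime-Bézout)
open import Data.Nat.GCD using (module Bézout)
open import Data.Integer using (ℤ; +_; _+_; _-_; _*_; -_; 0ℤ; 1ℤ; -1ℤ; ∣_∣)
open import Data.Integer.Properties
  using (+-identityʳ; +-inverseˡ; +-inverseʳ; *-identityˡ; *-identityʳ; *-zeroˡ; *-zeroʳ; *-comm; *-assoc;
         -1*i≡-i; neg-involutive; i-j≡0⇒i≡j; ∣i∣≡0⇒i≡0; ∣i-j∣≡∣j-i∣; m-n≡m⊖n; ∣m⊝n∣≤m⊔n; abs-*; pos-*; +-injective)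
open import Data.Integer.DivMod using (_%ℕ_; _/ℕ_; n%ℕd<d; a≡a%ℕn+[a/ℕn]*n)
import Data.Integer.Divisibility.Signed as Signed
open import Data.Integer.Tactic.RingSolver using (solve)
open import Data.Fin using (Fin; zero; suc; toℕ; fromℕ<)
open import Data.Fin.Properties using (toℕ<n; toℕ-fromℕ<; toℕ-injective)
open import Data.List using (_∷_; [])
open import Data.Product using (∃; ∃₂; _×_; _,_; proj₁; proj₂)
open import Data.Sum using (_⊎_; inj₁; inj₂; fromInj₂)
import Data.Sum as Sum
open import Function.Base using (_∘_)
open import Level using (0ℓ)
open import Relation.Nullary using (¬_; yes; no; contradiction)
open import Relation.Nullary.Decidable using (map′)
open import Relation.Binary.Bundles using (Setoid)
open import Relation.Binary.Definitions using (Decidable)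
open import Relation.Binary.Structures using (IsEquivalence)
open import Relation.Binary.PropositionalEquality using (_≡_; refl; sym; trans; cong; cong₂; subst; module ≡-Reasoning)
import Relation.Binary.Reasoning.Setoid as SetoidReasoning

odd⇒≡1+half+half : ∀ n → ¬ 2 ∣ n → n ≡ suc ((n ∸ 1) / 2 ℕ.+ (n ∸ 1) / 2)
odd⇒≡1+half+half ℕ.zero  ¬2∣n = contradiction (2 ∣0) ¬2∣n
odd⇒≡1+half+half (suc n) ¬2∣n with n % 2 | m%n<n n 2 | m≡m%n+[m/n]*n n 2
... | 0           | _                   | n≡ = cong suc (trans n≡ (double (n / 2)))
  where
  double : ∀ x → x ℕ.* 2 ≡ x ℕ.+ x
  double x = trans (ℕ.*-comm x 2) (cong (x ℕ.+_) (ℕ.+-identityʳ x))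
... | 1           | _                   | n≡ = contradiction (divides (suc (n / 2)) (cong suc n≡)) ¬2∣n
... | suc (suc _) | ℕ.s≤s (ℕ.s≤s ()) | _

prime≢2⇒odd : ∀ {p} → Prime p → p ≢ 2 → ¬ 2 ∣ p
prime≢2⇒odd p-prime p≢2 2∣p =
  prime⇒¬composite p-prime (composite-≢ 2 {{_}} {{prime⇒nonZero p-prime}} (p≢2 ∘ sym) 2∣p)

half-complement : ∀ {h m} → h ℕ.< m → m ℕ.≤ h ℕ.+ h → ∃ λ k → k ℕ.< h × k ℕ.+ m ≡ h ℕ.+ h
half-complement {h} {m} h<m m≤2h = h ℕ.+ h ∸ m , k<h , ℕ.m∸n+n≡m m≤2h
  where
  open ℕ.≤-Reasoning
  k<h : h ℕ.+ h ∸ m ℕ.< h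
  k<h = ℕ.+-cancelʳ-< h _ h (begin-strict
    (h ℕ.+ h ∸ m) ℕ.+ h  <⟨ ℕ.+-monoʳ-< (h ℕ.+ h ∸ m) h<m ⟩
    (h ℕ.+ h ∸ m) ℕ.+ m  ≡⟨ ℕ.m∸n+n≡m m≤2h ⟩
    h ℕ.+ h              ∎)

ℤ² : Set
ℤ² = ℤ × ℤ

det : ℤ² → ℤ² → ℤ
det (a , c) (b , d) = a * d - b * c

infixr 7 _·_
_·_ : ℤ → ℤ² → ℤ²
κ · (a , c) = κ * a , κ * c

det-self : ∀ v → det v v ≡ 0ℤ
det-self (a , c) = +-inverseʳ (a * c)

det-·ʳ : ∀ μ u v → det u (μ · v) ≡ μ * det u v
det-·ʳ μ (a , c) (b , d) = begin
  a * (μ * d) - μ * b * c  ≡⟨ solve (μ ∷ a ∷ c ∷ b ∷ d ∷ []) ⟩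
  μ * (a * d - b * c)      ∎
  where open ≡-Reasoning

det-·· : ∀ κ μ u v → det (κ · u) (μ · v) ≡ κ * (μ * det u v)
det-·· κ μ (a , c) (b , d) = begin
  κ * a * (μ * d) - μ * b * (κ * c)  ≡⟨ solve (κ ∷ μ ∷ a ∷ c ∷ b ∷ d ∷ []) ⟩
  κ * (μ * (a * d - b * c))          ∎
  where open ≡-Reasoning

det-·-self : ∀ κ μ v → det (κ · v) (μ · v) ≡ 0ℤ
det-·-self κ μ (a , c) = begin
  κ * a * (μ * c) - μ * a * (κ * c)  ≡⟨ solve (κ ∷ μ ∷ a ∷ c ∷ []) ⟩
  0ℤ                                 ∎
  where open ≡-Reasoning

·-assoc : ∀ κ μ v → κ · μ · v ≡ (κ * μ) · v
·-assoc κ μ (a , c) = cong₂ _,_ (sym (*-assoc κ μ a)) (sym (*-assoc κ μ c))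

module Congruence (m : ℕ) where

  infix 4 _≈_ _≈?_ _≋_

  -- Wrapped in a record so that _≈_ is injective: unfolded, x ≡ y [mod m ]
  -- is a divisibility of ∣ x - y ∣, from which x and y cannot be inferred.
  record _≈_ (x y : ℤ) : Set where
    constructor mod
    field
      unmod : x ≡ y [mod m ]

  open _≈_ public

  _≈?_ : Decidable _≈_
  x ≈? y = map′ mod unmod (m ∣? ∣ x - y ∣)

  private
    ≈-by : ∀ {x y} z → x - y ≡ z → + m Signed.∣ z → x ≈ y
    ≈-by z eq m∣z = mod (Signed.∣⇒∣ᵤ (subst (+ m Signed.∣_) (sym eq) m∣z))

    difference : ∀ {x y} → x ≈ y → + m Signed.∣ x - y
    difference = Signed.∣ᵤ⇒∣ ∘ unmod

  ≈-refl : ∀ {x} → x ≈ x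
  ≈-refl {x} = ≈-by 0ℤ (+-inverseʳ x) (Signed.∣n⇒∣m*n 0ℤ Signed.∣-refl)

  ≈-sym : ∀ {x y} → x ≈ y → y ≈ x
  ≈-sym {x} {y} (mod m∣x-y) = mod (subst (m ∣_) (∣i-j∣≡∣j-i∣ x y) m∣x-y)

  ≈-trans : ∀ {x y z} → x ≈ y → y ≈ z → x ≈ z
  ≈-trans {x} {y} {z} x≈y y≈z =
    ≈-by ((x - y) + (y - z)) (solve (x ∷ y ∷ z ∷ [])) (Signed.∣m∣n⇒∣m+n (difference x≈y) (difference y≈z))

  ≡⇒≈ : ∀ {x y} → x ≡ y → x ≈ y
  ≡⇒≈ refl = ≈-refl

  +-cong : ∀ {x y u v} → x ≈ y → u ≈ v → x + u ≈ y + v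
  +-cong {x} {y} {u} {v} x≈y u≈v =
    ≈-by ((x - y) + (u - v)) (solve (x ∷ y ∷ u ∷ v ∷ [])) (Signed.∣m∣n⇒∣m+n (difference x≈y) (difference u≈v))

  *-cong : ∀ {x y u v} → x ≈ y → u ≈ v → x * u ≈ y * v
  *-cong {x} {y} {u} {v} x≈y u≈v =
    ≈-by ((x - y) * u + y * (u - v)) (solve (x ∷ y ∷ u ∷ v ∷ []))
      (Signed.∣m∣n⇒∣m+n (Signed.∣m⇒∣m*n u (difference x≈y)) (Signed.∣n⇒∣m*n y (difference u≈v)))

  +-congˡ : ∀ x {u v} → u ≈ v → x + u ≈ x + v
  +-congˡ x = +-cong (≈-refl {x})

  +-congʳ : ∀ u {x y} → x ≈ y → x + u ≈ y + u
  +-congʳ u x≈y = +-cong x≈y (≈-refl {u})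

  *-congˡ : ∀ x {u v} → u ≈ v → x * u ≈ x * v
  *-congˡ x = *-cong (≈-refl {x})

  *-congʳ : ∀ u {x y} → x ≈ y → x * u ≈ y * u
  *-congʳ u x≈y = *-cong x≈y (≈-refl {u})

  neg-cong : ∀ {x y} → x ≈ y → - x ≈ - y
  neg-cong {x} {y} x≈y = ≈-by (- (x - y)) (solve (x ∷ y ∷ [])) (Signed.∣m⇒∣-m (difference x≈y))

  i-j≈0⇒i≈j : ∀ {x y} → x - y ≈ 0ℤ → x ≈ y
  i-j≈0⇒i≈j {x} {y} = ≈-by (x - y - 0ℤ) (sym (+-identityʳ (x - y))) ∘ difference

  modulus≈0 : + m ≈ 0ℤ
  modulus≈0 = ≈-by (+ m) (+-identityʳ (+ m)) Signed.∣-refl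

  multiple≈0 : ∀ k → k * + m ≈ 0ℤ
  multiple≈0 k = ≈-trans (*-congˡ k modulus≈0) (≡⇒≈ (*-zeroʳ k))

  ≈-isEquivalence : IsEquivalence _≈_
  ≈-isEquivalence = record { refl = ≈-refl ; sym = ≈-sym ; trans = ≈-trans }

  ≈-setoid : Setoid 0ℓ 0ℓ
  ≈-setoid = record { isEquivalence = ≈-isEquivalence }

  module ≈-Reasoning = SetoidReasoning ≈-setoid

  IsSign : ℤ → Set
  IsSign x = x ≈ 1ℤ ⊎ x ≈ -1ℤ

  IsSign-resp : ∀ {x y} → x ≈ y → IsSign x → IsSign y
  IsSign-resp x≈y = Sum.map (≈-trans (≈-sym x≈y)) (≈-trans (≈-sym x≈y))

  IsSign-neg : ∀ {x} → IsSign x → IsSign (- x)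
  IsSign-neg = Sum.swap ∘ Sum.map neg-cong neg-cong

  sign-ratio : ∀ {a b} κ → IsSign a → IsSign b → a ≈ κ * b → IsSign κ
  sign-ratio {a} {b} κ a± (inj₁ b≈1) a≈κb = IsSign-resp κ-is-a a±
    where
    open ≈-Reasoning
    κ-is-a : a ≈ κ
    κ-is-a = begin
      a          ≈⟨ a≈κb ⟩
      κ * b      ≈⟨ *-congˡ κ b≈1 ⟩
      κ * 1ℤ     ≡⟨ *-identityʳ κ ⟩
      κ          ∎
  sign-ratio {a} {b} κ a± (inj₂ b≈-1) a≈κb = IsSign-resp -κ-is-a (IsSign-neg a±)
    where
    open ≈-Reasoning
    -κ-is-a : - a ≈ κ
    -κ-is-a = begin
      - a              ≈⟨ neg-cong a≈κb ⟩
      - (κ * b)        ≈⟨ neg-cong (*-congˡ κ b≈-1) ⟩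
      - (κ * - 1ℤ)     ≡⟨ solve (κ ∷ []) ⟩
      κ                ∎

  record _≋_ (u v : ℤ²) : Set where
    constructor _,_
    field
      fst : proj₁ u ≈ proj₁ v
      snd : proj₂ u ≈ proj₂ v

  Null : ℤ² → Set
  Null (a , c) = a ≈ 0ℤ × c ≈ 0ℤ

  ≋-refl : ∀ {v} → v ≋ v
  ≋-refl = ≈-refl , ≈-refl

  ≋-trans : ∀ {u v w} → u ≋ v → v ≋ w → u ≋ w
  ≋-trans (a≈ , c≈) (a≈′ , c≈′) = ≈-trans a≈ a≈′ , ≈-trans c≈ c≈′

  ≡⇒≋ : ∀ {u v} → u ≡ v → u ≋ v
  ≡⇒≋ refl = ≋-refl

  ·-congˡ : ∀ {κ μ} v → κ ≈ μ → κ · v ≋ μ · v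
  ·-congˡ (a , c) κ≈μ = *-congʳ a κ≈μ , *-congʳ c κ≈μ

  ·-congʳ : ∀ κ {u v} → u ≋ v → κ · u ≋ κ · v
  ·-congʳ κ (a≈ , c≈) = *-congˡ κ a≈ , *-congˡ κ c≈

  det-cong : ∀ {u u′ v v′} → u ≋ u′ → v ≋ v′ → det u v ≈ det u′ v′
  det-cong (a≈ , c≈) (b≈ , d≈) = +-cong (*-cong a≈ d≈) (neg-cong (*-cong b≈ c≈))

  multiple-≉0 : ∀ {v κ u} → ¬ Null v → v ≋ κ · u → ¬ κ ≈ 0ℤ
  multiple-≉0 {κ = κ} {b , d} v≉0 (a≈ , c≈) κ≈0 = v≉0 (vanishes a≈ , vanishes c≈)
    where
    vanishes : ∀ {x y} → x ≈ κ * y → x ≈ 0ℤ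
    vanishes {y = y} x≈κy = ≈-trans x≈κy (≈-trans (*-congʳ y κ≈0) (≡⇒≈ (*-zeroˡ y)))

module PrimeModulus (p : ℕ) (p-prime : Prime p) where

  open Congruence p public

  instance
    p-nonZero : ℕ.NonZero p
    p-nonZero = prime⇒nonZero p-prime

    p-nonTrivial : ℕ.NonTrivial p
    p-nonTrivial = prime⇒nonTrivial p-prime

  private
    ≈0⇒∣ : ∀ {x} → x ≈ 0ℤ → p ∣ ∣ x ∣
    ≈0⇒∣ {x} (mod p∣x) = subst (λ z → p ∣ ∣ z ∣) (+-identityʳ x) p∣x

    ∣⇒≈0 : ∀ {x} → p ∣ ∣ x ∣ → x ≈ 0ℤ
    ∣⇒≈0 {x} p∣x = mod (subst (λ z → p ∣ ∣ z ∣) (sym (+-identityʳ x)) p∣x)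

  1≉0 : ¬ 1ℤ ≈ 0ℤ
  1≉0 1≈0 = ℕ.nonTrivial⇒≢1 (∣1⇒≡1 (≈0⇒∣ 1≈0))

  -1≉0 : ¬ -1ℤ ≈ 0ℤ
  -1≉0 -1≈0 = 1≉0 (neg-cong -1≈0)

  sign≉0 : ∀ {x} → IsSign x → ¬ x ≈ 0ℤ
  sign≉0 (inj₁ x≈1)  x≈0 = 1≉0 (≈-trans (≈-sym x≈1) x≈0)
  sign≉0 (inj₂ x≈-1) x≈0 = -1≉0 (≈-trans (≈-sym x≈-1) x≈0)

  nat-injective : ∀ {i j} → i ℕ.< p → j ℕ.< p → + i ≈ + j → i ≡ j
  nat-injective {i} {j} i<p j<p i≈j =
    +-injective (i-j≡0⇒i≡j (+ i) (+ j) (∣i∣≡0⇒i≡0 distance≡0))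
    where
    distance<p : ∣ + i - + j ∣ ℕ.< p
    distance<p = ℕ.≤-<-trans (subst (ℕ._≤ i ℕ.⊔ j) (cong ∣_∣ (sym (m-n≡m⊖n i j))) (∣m⊝n∣≤m⊔n i j))
                             (ℕ.⊔-lub i<p j<p)
    distance≡0 : ∣ + i - + j ∣ ≡ 0
    distance≡0 = trans (sym (m<n⇒m%n≡m distance<p)) (n∣m⇒m%n≡0 _ p (unmod i≈j))

  zero-product : ∀ x y → x * y ≈ 0ℤ → x ≈ 0ℤ ⊎ y ≈ 0ℤ
  zero-product x y xy≈0 =
    Sum.map ∣⇒≈0 ∣⇒≈0 (euclidsLemma ∣ x ∣ ∣ y ∣ p-prime (subst (p ∣_) (abs-* x y) (≈0⇒∣ xy≈0)))

  ≉0∧*≈0⇒≈0 : ∀ {x y} → ¬ x ≈ 0ℤ → x * y ≈ 0ℤ → y ≈ 0ℤ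
  ≉0∧*≈0⇒≈0 {x} {y} x≉0 xy≈0 = fromInj₂ (λ x≈0 → contradiction x≈0 x≉0) (zero-product x y xy≈0)

  *≈1⇒≉0 : ∀ {x y} → x * y ≈ 1ℤ → ¬ y ≈ 0ℤ
  *≈1⇒≉0 {x} xy≈1 y≈0 = 1≉0 (≈-trans (≈-sym xy≈1) (≈-trans (*-congˡ x y≈0) (≡⇒≈ (*-zeroʳ x))))

  nat-representative : ∀ x → ∃ λ r → r ℕ.< p × x ≈ + r
  nat-representative x = x %ℕ p , n%ℕd<d x p , i-j≈0⇒i≈j (begin
    x - + (x %ℕ p)                              ≡⟨ cong (_- + (x %ℕ p)) (a≡a%ℕn+[a/ℕn]*n x p) ⟩
    + (x %ℕ p) + (x /ℕ p) * + p - + (x %ℕ p)    ≡⟨ cancel (+ (x %ℕ p)) ((x /ℕ p) * + p) ⟩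
    (x /ℕ p) * + p                              ≈⟨ multiple≈0 (x /ℕ p) ⟩
    0ℤ                                          ∎)
    where
    open ≈-Reasoning
    cancel : ∀ a b → a + b - a ≡ b
    cancel a b = solve (a ∷ b ∷ [])

  nat-inverse : ∀ n → suc n ℕ.< p → ∃ λ y → + suc n * y ≈ 1ℤ
  nat-inverse n n<p with coprime-Bézout (prime⇒coprime p-prime n<p)
  ... | Bézout.+- a b 1+b[1+n]≡ap = - + b , (begin
    + suc n * - + b              ≡⟨ rearrange (+ suc n) (+ b) ⟩
    1ℤ - (1ℤ + + b * + suc n)    ≡⟨ cong (λ z → 1ℤ - (1ℤ + z)) (sym (pos-* b (suc n))) ⟩
    1ℤ - + (1 ℕ.+ b ℕ.* suc n)   ≡⟨ cong (λ z → 1ℤ - + z) 1+b[1+n]≡ap ⟩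
    1ℤ - + (a ℕ.* p)             ≡⟨ cong (λ z → 1ℤ - z) (pos-* a p) ⟩
    1ℤ - + a * + p               ≈⟨ +-congˡ 1ℤ (neg-cong (multiple≈0 (+ a))) ⟩
    1ℤ - 0ℤ                      ∎)
    where
    open ≈-Reasoning
    rearrange : ∀ x y → x * - y ≡ 1ℤ - (1ℤ + y * x)
    rearrange x y = solve (x ∷ y ∷ [])
  ... | Bézout.-+ a b 1+ap≡b[1+n] = + b , (begin
    + suc n * + b                ≡⟨ *-comm (+ suc n) (+ b) ⟩
    + b * + suc n                ≡⟨ sym (pos-* b (suc n)) ⟩
    + (b ℕ.* suc n)              ≡⟨ cong +_ (sym 1+ap≡b[1+n]) ⟩
    1ℤ + + (a ℕ.* p)             ≡⟨ cong (λ z → 1ℤ + z) (pos-* a p) ⟩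
    1ℤ + + a * + p               ≈⟨ +-congˡ 1ℤ (multiple≈0 (+ a)) ⟩
    1ℤ + 0ℤ                      ∎)
    where open ≈-Reasoning

  inverse : ∀ {x} → ¬ x ≈ 0ℤ → ∃ λ y → x * y ≈ 1ℤ
  inverse {x} x≉0 = invert (nat-representative x)
    where
    invert : (∃ λ r → r ℕ.< p × x ≈ + r) → ∃ λ y → x * y ≈ 1ℤ
    invert (ℕ.zero , _   , x≈0) = contradiction x≈0 x≉0
    invert (suc n  , r<p , x≈r) = let y , ry≈1 = nat-inverse n r<p in y , ≈-trans (*-congʳ y x≈r) ry≈1

  ·-nonnull : ∀ {κ v} → ¬ κ ≈ 0ℤ → ¬ Null v → ¬ Null (κ · v)
  ·-nonnull {κ} {a , c} κ≉0 v≉0 (κa≈0 , κc≈0) = v≉0 (≉0∧*≈0⇒≈0 κ≉0 κa≈0 , ≉0∧*≈0⇒≈0 κ≉0 κc≈0)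

  ·-cancelʳ : ∀ {κ μ v} → ¬ Null v → κ · v ≋ μ · v → κ ≈ μ
  ·-cancelʳ {κ} {μ} {a , c} v≉0 (κa≈μa , κc≈μc) =
    i-j≈0⇒i≈j (difference≈0 (zero-product (κ - μ) a (factor κa≈μa)) (zero-product (κ - μ) c (factor κc≈μc)))
    where
    factor : ∀ {x} → κ * x ≈ μ * x → (κ - μ) * x ≈ 0ℤ
    factor {x} κx≈μx = begin
      (κ - μ) * x    ≡⟨ solve (κ ∷ μ ∷ x ∷ []) ⟩
      κ * x - μ * x  ≈⟨ +-congʳ (- (μ * x)) κx≈μx ⟩
      μ * x - μ * x  ≡⟨ +-inverseʳ (μ * x) ⟩
      0ℤ             ∎
      where open ≈-Reasoning
    difference≈0 : κ - μ ≈ 0ℤ ⊎ a ≈ 0ℤ → κ - μ ≈ 0ℤ ⊎ c ≈ 0ℤ → κ - μ ≈ 0ℤ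
    difference≈0 (inj₁ κ-μ≈0) _            = κ-μ≈0
    difference≈0 (inj₂ _)     (inj₁ κ-μ≈0) = κ-μ≈0
    difference≈0 (inj₂ a≈0)   (inj₂ c≈0)   = contradiction (a≈0 , c≈0) v≉0

  multiple-of : ∀ {a b c d μ} → b * μ ≈ 1ℤ → a * d ≈ b * c → (a , c) ≋ (a * μ) · (b , d)
  multiple-of {a} {b} {c} {d} {μ} bμ≈1 ad≈bc = a≈ , c≈
    where
    open ≈-Reasoning
    a≈ : a ≈ a * μ * b
    a≈ = begin
      a             ≡⟨ *-identityʳ a ⟨
      a * 1ℤ        ≈⟨ *-congˡ a bμ≈1 ⟨
      a * (b * μ)   ≡⟨ solve (a ∷ b ∷ μ ∷ []) ⟩
      a * μ * b     ∎
    c≈ : c ≈ a * μ * d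
    c≈ = begin
      c             ≡⟨ *-identityˡ c ⟨
      1ℤ * c        ≈⟨ *-congʳ c bμ≈1 ⟨
      b * μ * c     ≡⟨ solve (b ∷ μ ∷ c ∷ []) ⟩
      μ * (b * c)   ≈⟨ *-congˡ μ ad≈bc ⟨
      μ * (a * d)   ≡⟨ solve (μ ∷ a ∷ d ∷ []) ⟩
      a * μ * d     ∎

  collinear⇒multiple : ∀ {v w} → ¬ Null w → det v w ≈ 0ℤ → ∃ λ κ → v ≋ κ · w
  collinear⇒multiple {a , c} {b , d} w≉0 det≈0 with b ≈? 0ℤ
  ... | no b≉0 = let μ , bμ≈1 = inverse b≉0 in a * μ , multiple-of bμ≈1 ad≈bc
    where
    ad≈bc : a * d ≈ b * c
    ad≈bc = i-j≈0⇒i≈j det≈0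
  ... | yes b≈0 = let μ , dμ≈1 = inverse d≉0 ; c≈ , a≈ = multiple-of dμ≈1 cb≈da in c * μ , (a≈ , c≈)
    where
    d≉0 : ¬ d ≈ 0ℤ
    d≉0 d≈0 = w≉0 (b≈0 , d≈0)
    cb≈da : c * b ≈ d * a
    cb≈da = ≈-trans (≡⇒≈ (*-comm c b)) (≈-trans (≈-sym (i-j≈0⇒i≈j det≈0)) (≡⇒≈ (*-comm a d)))

  -- The points of ℙ¹(𝔽ₚ): zero is ∞ = [1 : 0], and suc i is [i : 1].
  point : Fin (suc p) → ℤ²
  point zero    = 1ℤ , 0ℤ
  point (suc i) = + toℕ i , 1ℤ

  point-nonnull : ∀ t → ¬ Null (point t)
  point-nonnull zero    (1≈0 , _) = 1≉0 1≈0
  point-nonnull (suc i) (_ , 1≈0) = 1≉0 1≈0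

  det-point≈0⇒≡ : ∀ {s t} → det (point s) (point t) ≈ 0ℤ → s ≡ t
  det-point≈0⇒≡ {zero}  {zero}  _   = refl
  det-point≈0⇒≡ {zero}  {suc j} d≈0 =
    contradiction (≈-trans (≡⇒≈ (sym (cong (λ z → 1ℤ - z) (*-zeroʳ (+ toℕ j))))) d≈0) 1≉0
  det-point≈0⇒≡ {suc i} {zero}  d≈0 =
    contradiction (≈-trans (≡⇒≈ (sym (cong (_- 1ℤ) (*-zeroʳ (+ toℕ i))))) d≈0) -1≉0
  det-point≈0⇒≡ {suc i} {suc j} d≈0 =
    cong suc (toℕ-injective (nat-injective (toℕ<n i) (toℕ<n j) (i-j≈0⇒i≈j (≈-trans (≡⇒≈ i-j≡) d≈0))))
    where
    i-j≡ : + toℕ i - + toℕ j ≡ + toℕ i * 1ℤ - + toℕ j * 1ℤ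
    i-j≡ = sym (cong₂ _-_ (*-identityʳ (+ toℕ i)) (*-identityʳ (+ toℕ j)))

  record OnLine (v : ℤ²) (t : Fin (suc p)) : Set where
    constructor _,_
    field
      scale    : ℤ
      multiple : v ≋ scale · point t

  OnLine-unique : ∀ {v s t} → ¬ Null v → OnLine v s → OnLine v t → s ≡ t
  OnLine-unique {v} {s} {t} v≉0 (κ , v≋κs) (μ , v≋μt) =
    det-point≈0⇒≡ (≉0∧*≈0⇒≈0 (multiple-≉0 {κ = μ} v≉0 v≋μt)
                    (≉0∧*≈0⇒≈0 (multiple-≉0 {κ = κ} v≉0 v≋κs) κμdet≈0))
    where
    open ≈-Reasoning
    κμdet≈0 : κ * (μ * det (point s) (point t)) ≈ 0ℤ
    κμdet≈0 = begin
      κ * (μ * det (point s) (point t))   ≡⟨ det-·· κ μ (point s) (point t) ⟨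
      det (κ · point s) (μ · point t)     ≈⟨ det-cong v≋κs v≋μt ⟨
      det v v                             ≡⟨ det-self v ⟩
      0ℤ                                  ∎

  OnLine-det : ∀ {u v t} → OnLine u t → OnLine v t → det u v ≈ 0ℤ
  OnLine-det {t = t} (κ , u≋) (μ , v≋) = ≈-trans (det-cong u≋ v≋) (≡⇒≈ (det-·-self κ μ (point t)))

  OnLine-multiple : ∀ {u v κ t} → v ≋ κ · u → OnLine u t → OnLine v t
  OnLine-multiple {κ = κ} {t} v≋κu (μ , u≋μt) =
    κ * μ , ≋-trans v≋κu (≋-trans (·-congʳ κ u≋μt) (≡⇒≋ (·-assoc κ μ (point t))))

  nonnull⇒OnLine : ∀ {v} → ¬ Null v → ∃ (OnLine v)
  nonnull⇒OnLine {a , c} v≉0 with c ≈? 0ℤ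
  ... | yes c≈0 = zero , a , ≡⇒≈ (sym (*-identityʳ a)) , ≈-trans c≈0 (≡⇒≈ (sym (*-zeroʳ a)))
  ... | no c≉0  = let μ , cμ≈1 = inverse c≉0 in finite-point μ cμ≈1 (nat-representative (a * μ))
    where
    finite-point : ∀ μ → c * μ ≈ 1ℤ → (∃ λ r → r ℕ.< p × a * μ ≈ + r) → ∃ (OnLine (a , c))
    finite-point μ cμ≈1 (r , r<p , aμ≈r) = suc (fromℕ< r<p) , c , a≈ , ≡⇒≈ (sym (*-identityʳ c))
      where
      *-left-comm : ∀ x y z → x * (y * z) ≡ y * (x * z)
      *-left-comm x y z = solve (x ∷ y ∷ z ∷ [])
      a≈ : a ≈ c * + toℕ (fromℕ< r<p)
      a≈ = begin
        a                          ≡⟨ *-identityʳ a ⟨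
        a * 1ℤ                     ≈⟨ *-congˡ a cμ≈1 ⟨
        a * (c * μ)                ≡⟨ *-left-comm a c μ ⟩
        c * (a * μ)                ≈⟨ *-congˡ c aμ≈r ⟩
        c * + r                    ≡⟨ cong (λ i → c * + i) (toℕ-fromℕ< r<p) ⟨
        c * + toℕ (fromℕ< r<p)     ∎
        where open ≈-Reasoning

  module HalfSystem (h : ℕ) (p≡1+2h : p ≡ suc (h ℕ.+ h)) where

    ≤h+h⇒<p : ∀ {i} → i ℕ.≤ h ℕ.+ h → i ℕ.< p
    ≤h+h⇒<p i≤2h = subst (_ ℕ.<_) (sym p≡1+2h) (ℕ.s≤s i≤2h)

    ≤h⇒<p : ∀ {i} → i ℕ.≤ h → i ℕ.< p
    ≤h⇒<p i≤h = ≤h+h⇒<p (ℕ.≤-trans i≤h (ℕ.m≤m+n _ _))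

    half : Fin h → ℤ
    half k = + suc (toℕ k)

    half≉0 : ∀ k → ¬ half k ≈ 0ℤ
    half≉0 k k≈0 = ℕ.1+n≢0 (nat-injective (≤h⇒<p (toℕ<n k)) (≤h⇒<p ℕ.z≤n) k≈0)

    half-unique : ∀ {ε i j} → IsSign ε → half i ≈ ε * half j → i ≡ j
    half-unique {ε} {i} {j} (inj₁ ε≈1) i≈εj =
      toℕ-injective (ℕ.suc-injective (nat-injective (≤h⇒<p (toℕ<n i)) (≤h⇒<p (toℕ<n j)) i≈j))
      where
      i≈j : half i ≈ half j
      i≈j = ≈-trans i≈εj (≈-trans (*-congʳ (half j) ε≈1) (≡⇒≈ (*-identityˡ (half j))))
    half-unique {ε} {i} {j} (inj₂ ε≈-1) i≈εj =
      contradiction (nat-injective (≤h+h⇒<p (ℕ.+-mono-≤ (toℕ<n i) (toℕ<n j))) (≤h⇒<p ℕ.z≤n) i+j≈0) ℕ.1+n≢0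
      where
      open ≈-Reasoning
      i+j≈0 : half i + half j ≈ + 0
      i+j≈0 = begin
        half i + half j         ≈⟨ +-congʳ (half j) (≈-trans i≈εj (*-congʳ (half j) ε≈-1)) ⟩
        -1ℤ * half j + half j   ≡⟨ cong (_+ half j) (-1*i≡-i (half j)) ⟩
        - half j + half j       ≡⟨ +-inverseˡ (half j) ⟩
        0ℤ                      ∎

    nat-half-system : ∀ n → suc n ℕ.< p → ∃₂ λ ε k → IsSign ε × + suc n ≈ ε * half k
    nat-half-system n r<p with suc n ℕ.≤? h
    ... | yes r≤h = 1ℤ , fromℕ< r≤h , inj₁ ≈-refl , ≡⇒≈ r≡
      where
      r≡ : + suc n ≡ 1ℤ * half (fromℕ< r≤h)
      r≡ = trans (cong (λ i → + suc i) (sym (toℕ-fromℕ< r≤h))) (sym (*-identityˡ _))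
    ... | no r≰h = reflected (half-complement (ℕ.≰⇒> r≰h) (ℕ.s≤s⁻¹ (subst (suc n ℕ.<_) p≡1+2h r<p)))
      where
      reflected : (∃ λ k → k ℕ.< h × k ℕ.+ suc n ≡ h ℕ.+ h) → ∃₂ λ ε k → IsSign ε × + suc n ≈ ε * half k
      reflected (k , k<h , k+r≡2h) = -1ℤ , fromℕ< k<h , inj₂ ≈-refl , r≈-k
        where
        k̂ : ℤ
        k̂ = half (fromℕ< k<h)
        k̂+r≡p : k̂ + + suc n ≡ + p
        k̂+r≡p = begin
          + suc (toℕ (fromℕ< k<h) ℕ.+ suc n)  ≡⟨ cong (λ i → + suc (i ℕ.+ suc n)) (toℕ-fromℕ< k<h) ⟩
          + suc (k ℕ.+ suc n)                 ≡⟨ cong (λ i → + suc i) k+r≡2h ⟩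
          + suc (h ℕ.+ h)                     ≡⟨ cong +_ p≡1+2h ⟨
          + p                                 ∎
          where open ≡-Reasoning
        reflect : ∀ a b → b ≡ - 1ℤ * a + (a + b)
        reflect a b = solve (a ∷ b ∷ [])
        r≈-k : + suc n ≈ -1ℤ * k̂
        r≈-k = begin
          + suc n                  ≡⟨ reflect k̂ (+ suc n) ⟩
          - 1ℤ * k̂ + (k̂ + + suc n) ≡⟨ cong (λ z → - 1ℤ * k̂ + z) k̂+r≡p ⟩
          - 1ℤ * k̂ + + p           ≈⟨ +-congˡ (- 1ℤ * k̂) modulus≈0 ⟩
          - 1ℤ * k̂ + 0ℤ            ≡⟨ +-identityʳ _ ⟩
          -1ℤ * k̂                  ∎
          where open ≈-Reasoning

    half-system : ∀ {x} → ¬ x ≈ 0ℤ → ∃₂ λ ε k → IsSign ε × x ≈ ε * half k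
    half-system {x} x≉0 = classify (nat-representative x)
      where
      classify : (∃ λ r → r ℕ.< p × x ≈ + r) → ∃₂ λ ε k → IsSign ε × x ≈ ε * half k
      classify (ℕ.zero , _   , x≈0) = contradiction x≈0 x≉0
      classify (suc n  , r<p , x≈r) =
        let ε , k , ε± , r≈εk = nat-half-system n r<p in ε , k , ε± , ≈-trans x≈r r≈εk

module FareyCovering (p : ℕ) (p-prime : Prime p) where

  open PrimeModulus p p-prime

  Vertex : Set
  Vertex = G3Vertex p

  vertex : ∀ v → ¬ Null v → Vertex
  vertex v v≉0 = v , λ (a≡0 , c≡0) → v≉0 (mod a≡0 , mod c≡0)

  vertex-nonnull : ∀ (w : Vertex) → ¬ Null (proj₁ w)
  vertex-nonnull (_ , v≉0) (a≈0 , c≈0) = v≉0 (unmod a≈0 , unmod c≈0)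

  adjacent⇒det-sign : ∀ {w w′} → G3Adj p w w′ → IsSign (det (proj₁ w) (proj₁ w′))
  adjacent⇒det-sign = Sum.map mod mod

  line : Vertex → Fin (suc p)
  line w = proj₁ (nonnull⇒OnLine (vertex-nonnull w))

  line-OnLine : ∀ w → OnLine (proj₁ w) (line w)
  line-OnLine w = proj₂ (nonnull⇒OnLine (vertex-nonnull w))

  line-unique : ∀ w {t} → OnLine (proj₁ w) t → line w ≡ t
  line-unique w = OnLine-unique (vertex-nonnull w) (line-OnLine w)

  equiv⇒sign-multiple : ∀ {w w′} → G3Equiv p w w′ → ∃ λ κ → IsSign κ × proj₁ w′ ≋ κ · proj₁ w
  equiv⇒sign-multiple (inj₁ (a≡b , c≡d)) = 1ℤ , inj₁ ≈-refl , (same (mod a≡b) , same (mod c≡d))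
    where
    same : ∀ {x y} → x ≈ y → y ≈ 1ℤ * x
    same {x} x≈y = ≈-trans (≈-sym x≈y) (≡⇒≈ (sym (*-identityˡ x)))
  equiv⇒sign-multiple (inj₂ (a≡-b , c≡-d)) = -1ℤ , inj₂ ≈-refl , (opposite (mod a≡-b) , opposite (mod c≡-d))
    where
    opposite : ∀ {x y} → x ≈ - y → y ≈ -1ℤ * x
    opposite {x} {y} x≈-y = begin
      y          ≡⟨ neg-involutive y ⟨
      - - y      ≈⟨ neg-cong x≈-y ⟨
      - x        ≡⟨ -1*i≡-i x ⟨
      -1ℤ * x    ∎
      where open ≈-Reasoning

  sign-multiple⇒equiv : ∀ {w w′} κ → IsSign κ → proj₁ w ≋ κ · proj₁ w′ → G3Equiv p w w′
  sign-multiple⇒equiv κ (inj₁ κ≈1) (a≈ , c≈) = inj₁ (unmod (unit a≈) , unmod (unit c≈))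
    where
    unit : ∀ {x y} → x ≈ κ * y → x ≈ y
    unit {x} {y} x≈κy = begin
      x        ≈⟨ x≈κy ⟩
      κ * y    ≈⟨ *-congʳ y κ≈1 ⟩
      1ℤ * y   ≡⟨ *-identityˡ y ⟩
      y        ∎
      where open ≈-Reasoning
  sign-multiple⇒equiv κ (inj₂ κ≈-1) (a≈ , c≈) = inj₂ (unmod (unit a≈) , unmod (unit c≈))
    where
    unit : ∀ {x y} → x ≈ κ * y → x ≈ - y
    unit {x} {y} x≈κy = begin
      x         ≈⟨ x≈κy ⟩
      κ * y     ≈⟨ *-congʳ y κ≈-1 ⟩
      -1ℤ * y   ≡⟨ -1*i≡-i y ⟩
      - y       ∎
      where open ≈-Reasoning

  line-resp : ∀ {w w′} → G3Equiv p w w′ → line w ≡ line w′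
  line-resp {w} {w′} w≈w′ =
    let κ , _ , w′≋κw = equiv⇒sign-multiple {w} {w′} w≈w′
    in sym (line-unique w′ (OnLine-multiple {κ = κ} w′≋κw (line-OnLine w)))

  line-adj : ∀ {w w′} → G3Adj p w w′ → line w ≢ line w′
  line-adj {w} {w′} w~w′ same =
    sign≉0 (adjacent⇒det-sign {w} {w′} w~w′)
      (OnLine-det (subst (OnLine (proj₁ w)) same (line-OnLine w)) (line-OnLine w′))

  off-line⇒det≉0 : ∀ w t → line w ≢ t → ¬ det (proj₁ w) (point t) ≈ 0ℤ
  off-line⇒det≉0 w t w↛t δ≈0 =
    let κ , v≋κt = collinear⇒multiple (point-nonnull t) δ≈0 in w↛t (line-unique w (κ , v≋κt))

  line-onto : ∀ w t → line w ≢ t → ∃ λ w′ → G3Adj p w w′ × line w′ ≡ t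
  line-onto w@(v , _) t w↛t = neighbour (inverse (off-line⇒det≉0 w t w↛t))
    where
    neighbour : (∃ λ μ → det v (point t) * μ ≈ 1ℤ) → ∃ λ w′ → G3Adj p w w′ × line w′ ≡ t
    neighbour (μ , δμ≈1) = w′ , inj₁ (unmod det≈1) , line-unique w′ (μ , ≋-refl)
      where
      w′ : Vertex
      w′ = vertex (μ · point t) (·-nonnull {μ} (*≈1⇒≉0 {det v (point t)} δμ≈1) (point-nonnull t))
      det≈1 : det v (μ · point t) ≈ 1ℤ
      det≈1 = begin
        det v (μ · point t)     ≡⟨ det-·ʳ μ v (point t) ⟩
        μ * det v (point t)     ≡⟨ *-comm μ _ ⟩
        det v (point t) * μ     ≈⟨ δμ≈1 ⟩
        1ℤ                      ∎
        where open ≈-Reasoning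

  line-inj : ∀ w w₁ w₂ → G3Adj p w w₁ → G3Adj p w w₂ → line w₁ ≡ line w₂ → G3Equiv p w₁ w₂
  line-inj w@(v , _) w₁@(v₁ , _) w₂@(v₂ , _) w~w₁ w~w₂ same =
    same-sign (collinear⇒multiple (vertex-nonnull w₂)
      (OnLine-det (subst (OnLine v₁) same (line-OnLine w₁)) (line-OnLine w₂)))
    where
    same-sign : (∃ λ κ → v₁ ≋ κ · v₂) → G3Equiv p w₁ w₂
    same-sign (κ , v₁≋κv₂) = sign-multiple⇒equiv {w₁} {w₂} κ
      (sign-ratio κ (adjacent⇒det-sign {w} {w₁} w~w₁) (adjacent⇒det-sign {w} {w₂} w~w₂) d₁≈κd₂) v₁≋κv₂
      where
      d₁≈κd₂ : det v v₁ ≈ κ * det v v₂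
      d₁≈κd₂ = begin
        det v v₁          ≈⟨ det-cong (≋-refl {v}) v₁≋κv₂ ⟩
        det v (κ · v₂)    ≡⟨ det-·ʳ κ v v₂ ⟩
        κ * det v v₂      ∎
        where open ≈-Reasoning

  line-isCovering : IsCovering (𝒢₃ p) (K (suc p)) line
  line-isCovering = record
    { resp = λ {w} {w′} → line-resp {w} {w′}
    ; adj  = λ {w} {w′} → line-adj {w} {w′}
    ; onto = line-onto
    ; inj  = line-inj
    }

  module Fibres (h : ℕ) (p≡1+2h : p ≡ suc (h ℕ.+ h)) where

    open HalfSystem h p≡1+2h

    fibre : Fin (suc p) → Fin h → Vertex
    fibre t k = vertex (half k · point t) (·-nonnull (half≉0 k) (point-nonnull t))

    line-fibre : ∀ t k → line (fibre t k) ≡ t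
    line-fibre t k = line-unique (fibre t k) (half k , ≋-refl)

    fibre-injective : ∀ t i j → G3Equiv p (fibre t i) (fibre t j) → i ≡ j
    fibre-injective t i j i≈j = sym (cancel (equiv⇒sign-multiple {fibre t i} {fibre t j} i≈j))
      where
      cancel : (∃ λ ε → IsSign ε × half j · point t ≋ ε · half i · point t) → j ≡ i
      cancel (ε , ε± , j≋ε·i) =
        half-unique ε± (·-cancelʳ (point-nonnull t) (≋-trans j≋ε·i (≡⇒≋ (·-assoc ε (half i) (point t)))))

    fibre-complete : ∀ t w → line w ≡ t → ∃ λ k → G3Equiv p w (fibre t k)
    fibre-complete t w w↦t = representative (subst (OnLine (proj₁ w)) w↦t (line-OnLine w))
      where
      representative : OnLine (proj₁ w) t → ∃ λ k → G3Equiv p w (fibre t k)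
      representative (κ , v≋κt) =
        let ε , k , ε± , κ≈εk = half-system (multiple-≉0 {κ = κ} {point t} (vertex-nonnull w) v≋κt)
            v≋ε·k = ≋-trans v≋κt (≋-trans (·-congˡ (point t) κ≈εk) (≡⇒≋ (sym (·-assoc ε (half k) (point t)))))
        in k , sign-multiple⇒equiv {w} {fibre t k} ε ε± v≋ε·k

    line-hasOrder : HasOrder (𝒢₃ p) (K (suc p)) line h
    line-hasOrder t = fibre t , line-fibre t , fibre-injective t , fibre-complete t

theorem5p1 : (p : ℕ) → Prime p → p ≢ 2 →
    GraphCovering (𝒢₃ p) (K (suc p)) ((p ∸ 1) / 2)
theorem5p1 p p-prime p≢2 = line , line-isCovering , line-hasOrder
  where
  open FareyCovering p p-prime
  open Fibres ((p ∸ 1) / 2) (odd⇒≡1+half+half p (prime≢2⇒odd p-prime p≢2))
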